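{- Let $0\le d\le n$ and $0\le s\le\min\{d,n-d\}$. Then the standard monomials of $I(\mathcal V(n,d,2))$ of degree at most $s$ are exactly the standard monomials of $I(\mathcal V(n,s,2))$.
   Context: $R=\mathbb{Q}[x_1,\ldots,x_n]$ with a fixed monomial order $\prec$ satisfying $x_n\prec\cdots\prec x_1$. A standard monomial of an ideal $I$ is a monomial that is not the leading ($\prec$-largest) monomial of any nonzero element of $I$. $\mathcal V(n,d,2)=\{\mathbf v\in\{0,1\}^n: |\{i:v_i\ne0\}|=d\}$, and $I(\mathcal V)$ is the ideal of polynomials vanishing on $\mathcal V$. -}

module Defs where

open import Data.Nat as ℕ using (ℕ; zero; suc)
open import Data.Rational as ℚ using (ℚ; 0ℚ; 1ℚ)
open import Data.Rational.Properties using () renaming (_≟_ to _≟ℚ_)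
open import Data.Nat.Properties using () renaming (_≟_ to _≟ℕ_)
open import Data.Fin as Fin using (Fin; _<_)
open import Data.Vec using (Vec; []; _∷_; zipWith; lookup; tabulate; replicate; foldr)
open import Data.Vec.Properties using (≡-dec)
open import Data.List using (List; []; _∷_)
open import Data.Product using (Σ; _×_; _,_)
open import Data.Sum using (_⊎_)
open import Relation.Nullary using (¬_; yes; no)
open import Relation.Binary.PropositionalEquality using (_≡_; _≢_)
open import Relation.Binary.Structures using (IsStrictTotalOrder)
open import Induction.WellFounded using (WellFounded)

-- Monomials in x_1..x_n: exponent vectors (index i : Fin n is variable x_{i+1}).
Monomial : ℕ → Set
Monomial n = Vec ℕ n

_·_ : ∀ {n} → Monomial n → Monomial n → Monomial n
_·_ = zipWith ℕ._+_

var : ∀ {n} → Fin n → Monomial n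
var i = tabulate (δ i)
  where
  δ : ∀ {m} → Fin m → Fin m → ℕ
  δ Fin.zero Fin.zero = 1
  δ Fin.zero (Fin.suc _) = 0
  δ (Fin.suc _) Fin.zero = 0
  δ (Fin.suc a) (Fin.suc b) = δ a b

deg : ∀ {n} → Monomial n → ℕ
deg = foldr _ ℕ._+_ 0

record MonomialOrder (n : ℕ) : Set₁ where
  field
    _≺_ : Monomial n → Monomial n → Set
    isStrictTotalOrder : IsStrictTotalOrder _≡_ _≺_
    wellFounded : WellFounded _≺_
    multiplicative : ∀ a b c → a ≺ b → (a · c) ≺ (b · c)
    varOrder : ∀ (i j : Fin n) → i < j → var j ≺ var i

Poly : ℕ → Set
Poly n = List (ℚ × Monomial n)

-- coefficient of the monomial m in f (after collecting like terms)
coeff : ∀ {n} → Poly n → Monomial n → ℚ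
coeff [] m = 0ℚ
coeff ((c , a) ∷ f) m with ≡-dec _≟ℕ_ a m
... | yes _ = c ℚ.+ coeff f m
... | no _ = coeff f m

pow : ℚ → ℕ → ℚ
pow x zero = 1ℚ
pow x (suc k) = x ℚ.* pow x k

evalMon : ∀ {n} → Monomial n → Vec ℚ n → ℚ
evalMon [] [] = 1ℚ
evalMon (a ∷ as) (x ∷ xs) = pow x a ℚ.* evalMon as xs

eval : ∀ {n} → Poly n → Vec ℚ n → ℚ
eval [] x = 0ℚ
eval ((c , a) ∷ f) x = c ℚ.* evalMon a x ℚ.+ eval f x

support : ∀ {n} → Vec ℚ n → ℕ
support [] = 0
support (x ∷ xs) with x ≟ℚ 0ℚ
... | yes _ = support xs
... | no _ = suc (support xs)

𝒱 : (n d : ℕ) → Vec ℚ n → Set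
𝒱 n d v = (∀ i → lookup v i ≡ 0ℚ ⊎ lookup v i ≡ 1ℚ) × support v ≡ d

InIdeal : ∀ {n} → (Vec ℚ n → Set) → Poly n → Set
InIdeal V f = ∀ v → V v → eval f v ≡ 0ℚ

IsLeadingMonomial : ∀ {n} → MonomialOrder n → Poly n → Monomial n → Set
IsLeadingMonomial O f m =
  coeff f m ≢ 0ℚ × (∀ a → coeff f a ≢ 0ℚ → a ≡ m ⊎ a ≺ m)
  where open MonomialOrder O

IsStandard : ∀ {n} → MonomialOrder n → (Vec ℚ n → Set) → Monomial n → Set
IsStandard O V m = ¬ (Σ (Poly _) λ f → InIdeal V f × IsLeadingMonomial O f m)

module Submission where

-- For a point v ∈ {0,1}ⁿ with k ones, put Σ↓ f (v) = Σ_{vᵢ=1} f(v − eᵢ) and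
-- Σ↑ f (v) = Σ_{vᵢ=0} f(v + eᵢ); they map I(𝒱(n,k−1)), resp. I(𝒱(n,k+1)), into
-- I(𝒱(n,k)). On {0,1}ⁿ both are again given by polynomials: Σ↓ multiplies x^a by
-- k − t, and Σ↑ sends x^a to (n − k − t)·x^a plus proper divisors of x^a, where t
-- is the number of variables of x^a. When these scalars are nonzero the leading
-- monomial is preserved, so for s ≤ d and t + d ≤ n a monomial in t ≤ s variables
-- is standard for 𝒱(n,s) iff it is standard for 𝒱(n,d). Finally a standard
-- monomial of 𝒱(n,s) has degree at most s: x_i² − x_i vanishes on {0,1}ⁿ, and a
-- product of more than s variables vanishes on 𝒱(n,s).

open import Defs
open import Data.Nat as ℕ using (ℕ; zero; suc; _≤_; _<_; _∸_; z≤n; s≤s)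
import Data.Nat.Properties as ℕP
open import Data.Nat.Properties using () renaming (_≟_ to _≟ℕ_)
open import Data.Rational as ℚ using (ℚ; 0ℚ; 1ℚ; _+_; _*_; _-_; -_; 1/_)
import Data.Rational.Properties as ℚP
open import Data.Rational.Solver using (module +-*-Solver)
open +-*-Solver
open import Data.Vec using (Vec; []; _∷_; replicate)
open import Data.Vec.Properties using (∷-injectiveʳ; ≡-dec)
open import Data.Vec.Relation.Unary.All as VecAll using ([]; _∷_)
open import Data.Vec.Relation.Unary.All.Properties using (lookup⁺; lookup⁻)
open import Data.List as List using (List; []; _∷_; _++_; [_]; filter; length; concatMap)
open import Data.List.Properties using (filter-notAll)
open import Data.List.Relation.Unary.All as All using (All; []; _∷_)
open import Data.List.Relation.Unary.All.Properties using (map⁺; ++⁺; all-filter)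
open import Data.List.Relation.Unary.Any using (here)
open import Data.Product using (_×_; _,_; proj₂; ∃-syntax)
open import Data.Sum using (_⊎_; inj₁; inj₂)
open import Data.Empty using (⊥; ⊥-elim)
open import Function using (_∘_)
open import Function.Bundles using (_⇔_; mk⇔; Equivalence)
import Function.Properties.Equivalence as ⇔
open import Induction.WellFounded using (Acc; acc)
open import Level using (0ℓ)
open import Relation.Nullary using (¬_; yes; no; contradiction)
open import Relation.Nullary.Decidable using (decidable-stable)
open import Relation.Unary using (Pred; Decidable)
open import Relation.Unary.Properties using (∁?)
open import Relation.Binary.Definitions using (tri<; tri≈; tri>)
open import Relation.Binary.Structures using (IsStrictTotalOrder)
open import Relation.Binary.PropositionalEquality
  using (_≡_; _≢_; refl; sym; trans; cong; cong₂; subst; module ≡-Reasoning)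

fromℕ : ℕ → ℚ
fromℕ zero = 0ℚ
fromℕ (suc k) = 1ℚ + fromℕ k

fromℕ-nonNeg : ∀ k → 0ℚ ℚ.≤ fromℕ k
fromℕ-nonNeg zero = ℚP.≤-refl
fromℕ-nonNeg (suc k) = ℚP.+-mono-≤ (ℚP.<⇒≤ (ℚP.positive⁻¹ 1ℚ)) (fromℕ-nonNeg k)

fromℕ-suc≢0 : ∀ k → fromℕ (suc k) ≢ 0ℚ
fromℕ-suc≢0 k eq = ℚP.<⇒≢ (ℚP.+-mono-<-≤ (ℚP.positive⁻¹ 1ℚ) (fromℕ-nonNeg k)) (sym eq)

fromℕ-∸ : ∀ {a b} → b ≤ a → fromℕ a - fromℕ b ≡ fromℕ (a ∸ b)
fromℕ-∸ {a} z≤n = solve 1 (λ x → x :- con 0ℚ := x) refl (fromℕ a)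
fromℕ-∸ {suc a} {suc b} (s≤s b≤a) =
  trans (solve 2 (λ x y → (con 1ℚ :+ x) :- (con 1ℚ :+ y) := x :- y) refl (fromℕ a) (fromℕ b))
        (fromℕ-∸ b≤a)

fromℕ-∸≢0 : ∀ {a b} → b < a → fromℕ a - fromℕ b ≢ 0ℚ
fromℕ-∸≢0 {suc a} {b} (s≤s b≤a) rewrite fromℕ-∸ (ℕP.m≤n⇒m≤1+n b≤a) | ℕP.+-∸-assoc 1 b≤a =
  fromℕ-suc≢0 (a ∸ b)

*-≢0 : ∀ {p q} → p ≢ 0ℚ → q ≢ 0ℚ → p * q ≢ 0ℚ
*-≢0 {p} {q} p≢0 q≢0 pq≡0 = p≢0 (begin
  p               ≡⟨ sym (ℚP.*-identityʳ p) ⟩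
  p * 1ℚ          ≡⟨ cong (p *_) (sym (ℚP.*-inverseʳ q)) ⟩
  p * (q * 1/ q)  ≡⟨ sym (ℚP.*-assoc p q (1/ q)) ⟩
  (p * q) * 1/ q  ≡⟨ cong (_* 1/ q) pq≡0 ⟩
  0ℚ * 1/ q       ≡⟨ ℚP.*-zeroˡ (1/ q) ⟩
  0ℚ              ∎)
  where
  open ≡-Reasoning
  instance _ = ℚ.≢-nonZero q≢0

p*q≢0⇒p≢0 : ∀ {p q} → p * q ≢ 0ℚ → p ≢ 0ℚ
p*q≢0⇒p≢0 {q = q} pq≢0 refl = pq≢0 (ℚP.*-zeroˡ q)

0^suc≡0 : ∀ k → pow 0ℚ (suc k) ≡ 0ℚ
0^suc≡0 k = ℚP.*-zeroˡ (pow 0ℚ k)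

1^k≡1 : ∀ k → pow 1ℚ k ≡ 1ℚ
1^k≡1 zero = refl
1^k≡1 (suc k) = trans (ℚP.*-identityˡ (pow 1ℚ k)) (1^k≡1 k)

one : ∀ {n} → Monomial n
one = replicate _ 0

·-identityˡ : ∀ {n} (b : Monomial n) → one · b ≡ b
·-identityˡ [] = refl
·-identityˡ (x ∷ b) = cong (x ∷_) (·-identityˡ b)

ProperlyDivides : ∀ {n} → Monomial n → Monomial n → Set
ProperlyDivides b a = ∃[ c ] (c ≢ one × c · b ≡ a)

properlyDivides-∷ : ∀ {n k} {b a : Monomial n} → ProperlyDivides b a → ProperlyDivides (k ∷ b) (k ∷ a)
properlyDivides-∷ {k = k} (c , c≢1 , c·b≡a) = 0 ∷ c , (λ eq → c≢1 (∷-injectiveʳ eq)) , cong (k ∷_) c·b≡a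

#vars : ∀ {n} → Monomial n → ℕ
#vars [] = 0
#vars (zero ∷ a) = #vars a
#vars (suc _ ∷ a) = suc (#vars a)

#vars≤deg : ∀ {n} (a : Monomial n) → #vars a ≤ deg a
#vars≤deg [] = z≤n
#vars≤deg (zero ∷ a) = #vars≤deg a
#vars≤deg (suc k ∷ a) = s≤s (ℕP.≤-trans (#vars≤deg a) (ℕP.m≤n+m (deg a) k))

drops : ∀ {n} → Monomial n → List (Monomial n)
drops [] = []
drops (zero ∷ a) = List.map (zero ∷_) (drops a)
drops (suc k ∷ a) = (0 ∷ a) ∷ List.map (suc k ∷_) (drops a)

drops-properlyDivide : ∀ {n} (a : Monomial n) → All (λ b → ProperlyDivides b a) (drops a)
drops-properlyDivide [] = []
drops-properlyDivide (zero ∷ a) =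
  map⁺ (All.map properlyDivides-∷ (drops-properlyDivide a))
drops-properlyDivide (suc k ∷ a) =
  (suc k ∷ one , (λ ()) , cong₂ _∷_ (ℕP.+-identityʳ (suc k)) (·-identityˡ a))
  ∷ map⁺ (All.map properlyDivides-∷ (drops-properlyDivide a))

Bit : ℚ → Set
Bit x = x ≡ 0ℚ ⊎ x ≡ 1ℚ

Binary : ∀ {n} → Vec ℚ n → Set
Binary = VecAll.All Bit

𝒱⇒binary : ∀ {n k v} → 𝒱 n k v → Binary v
𝒱⇒binary (bits , _) = lookup⁻ bits

binary⇒𝒱 : ∀ {n k} {v : Vec ℚ n} → Binary v → support v ≡ k → 𝒱 n k v
binary⇒𝒱 bin supp = lookup⁺ bin , supp

evalMon-vanishes : ∀ {n} (a : Monomial n) {v} → Binary v → support v < #vars a → evalMon a v ≡ 0ℚ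
evalMon-vanishes (zero ∷ a) {_ ∷ v} (inj₁ refl ∷ bin) lt =
  trans (ℚP.*-identityˡ _) (evalMon-vanishes a bin lt)
evalMon-vanishes (zero ∷ a) {_ ∷ v} (inj₂ refl ∷ bin) lt =
  trans (ℚP.*-identityˡ _) (evalMon-vanishes a bin (ℕP.<-trans (ℕP.n<1+n _) lt))
evalMon-vanishes (suc k ∷ a) {_ ∷ v} (inj₁ refl ∷ bin) lt =
  trans (cong (_* evalMon a v) (0^suc≡0 k)) (ℚP.*-zeroˡ (evalMon a v))
evalMon-vanishes (suc k ∷ a) {_ ∷ v} (inj₂ refl ∷ bin) (s≤s lt) =
  trans (cong (pow 1ℚ (suc k) *_) (evalMon-vanishes a bin lt)) (ℚP.*-zeroʳ (pow 1ℚ (suc k)))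

lowerExponent : ∀ {n} (a : Monomial n) → #vars a < deg a →
  ∃[ b ] (ProperlyDivides b a × (∀ {v} → Binary v → evalMon a v ≡ evalMon b v))
lowerExponent (zero ∷ a) lt with lowerExponent a lt
... | b , b∣a , same = 0 ∷ b , properlyDivides-∷ b∣a , λ { {x ∷ _} (_ ∷ bin) → cong (pow x 0 *_) (same bin) }
lowerExponent (suc zero ∷ a) (s≤s lt) with lowerExponent a lt
... | b , b∣a , same = 1 ∷ b , properlyDivides-∷ b∣a , λ { {x ∷ _} (_ ∷ bin) → cong (pow x 1 *_) (same bin) }
lowerExponent (suc (suc k) ∷ a) _ =
  suc k ∷ a , (1 ∷ one , (λ ()) , cong (suc (suc k) ∷_) (·-identityˡ a)) , same
  where
  same : ∀ {v} → Binary v → evalMon (suc (suc k) ∷ a) v ≡ evalMon (suc k ∷ a) v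
  same {_ ∷ v} (inj₁ refl ∷ _) = cong (_* evalMon a v) (trans (0^suc≡0 (suc k)) (sym (0^suc≡0 k)))
  same {_ ∷ v} (inj₂ refl ∷ _) = cong (_* evalMon a v) (trans (1^k≡1 (suc (suc k))) (sym (1^k≡1 (suc k))))

-- Sums over adjacent levels

Σ-shift : ∀ {n} → (ℚ → ℚ) → ℚ → (Vec ℚ n → ℚ) → Vec ℚ n → ℚ
Σ-shift ω t g [] = 0ℚ
Σ-shift ω t g (x ∷ v) = ω x * g (t ∷ v) + Σ-shift ω t (λ u → g (x ∷ u)) v

-- On a binary v these sum g over the binary points one level below, resp. above, v.
Σ↓ Σ↑ : ∀ {n} → (Vec ℚ n → ℚ) → Vec ℚ n → ℚ
Σ↓ = Σ-shift (λ x → x) 0ℚ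
Σ↑ = Σ-shift (λ x → 1ℚ - x) 1ℚ

Σ-shift-zero : ∀ {n} ω t (v : Vec ℚ n) → Σ-shift ω t (λ _ → 0ℚ) v ≡ 0ℚ
Σ-shift-zero ω t [] = refl
Σ-shift-zero ω t (x ∷ v) = cong₂ _+_ (ℚP.*-zeroʳ (ω x)) (Σ-shift-zero ω t v)

Σ-shift-*ˡ : ∀ {n} ω t c (g : Vec ℚ n → ℚ) v → Σ-shift ω t (λ u → c * g u) v ≡ c * Σ-shift ω t g v
Σ-shift-*ˡ ω t c g [] = sym (ℚP.*-zeroʳ c)
Σ-shift-*ˡ ω t c g (x ∷ v) =
  trans (cong (ω x * (c * g (t ∷ v)) +_) (Σ-shift-*ˡ ω t c (λ u → g (x ∷ u)) v))
        (solve 4 (λ w c g₀ r → w :* (c :* g₀) :+ c :* r := c :* (w :* g₀ :+ r)) refl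
               (ω x) c (g (t ∷ v)) (Σ-shift ω t (λ u → g (x ∷ u)) v))

Σ-shift-+ : ∀ {n} ω t (g h : Vec ℚ n → ℚ) v → Σ-shift ω t (λ u → g u + h u) v ≡ Σ-shift ω t g v + Σ-shift ω t h v
Σ-shift-+ ω t g h [] = refl
Σ-shift-+ ω t g h (x ∷ v) =
  trans (cong (ω x * (g (t ∷ v) + h (t ∷ v)) +_) (Σ-shift-+ ω t (λ u → g (x ∷ u)) (λ u → h (x ∷ u)) v))
        (solve 5 (λ w g₀ h₀ r s → w :* (g₀ :+ h₀) :+ (r :+ s) := (w :* g₀ :+ r) :+ (w :* h₀ :+ s)) refl
               (ω x) (g (t ∷ v)) (h (t ∷ v)) (Σ-shift ω t (λ u → g (x ∷ u)) v) (Σ-shift ω t (λ u → h (x ∷ u)) v))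

Σ↓-evalMon : ∀ {n} (a : Monomial n) {w} → Binary w →
  Σ↓ (evalMon a) w ≡ (fromℕ (support w) - fromℕ (#vars a)) * evalMon a w
Σ↓-evalMon [] [] = sym (ℚP.*-zeroˡ 1ℚ)
Σ↓-evalMon (e ∷ a) {x ∷ w} (bit ∷ bin) =
  trans (cong (x * (pow 0ℚ e * evalMon a w) +_)
              (trans (Σ-shift-*ˡ (λ x → x) 0ℚ (pow x e) (evalMon a) w)
                     (cong (pow x e *_) (Σ↓-evalMon a bin))))
        (step e bit)
  where
  m = evalMon a w
  S = fromℕ (support w)
  t = fromℕ (#vars a)
  step : ∀ e {x} → Bit x → x * (pow 0ℚ e * m) + pow x e * ((S - t) * m)
                            ≡ (fromℕ (support (x ∷ w)) - fromℕ (#vars (e ∷ a))) * (pow x e * m)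
  step zero (inj₁ refl) =
    solve 3 (λ m S t → con 0ℚ :* (con 1ℚ :* m) :+ con 1ℚ :* ((S :- t) :* m) := (S :- t) :* (con 1ℚ :* m)) refl m S t
  step zero (inj₂ refl) =
    solve 3 (λ m S t → con 1ℚ :* (con 1ℚ :* m) :+ con 1ℚ :* ((S :- t) :* m) := ((con 1ℚ :+ S) :- t) :* (con 1ℚ :* m)) refl m S t
  step (suc k) (inj₁ refl) rewrite 0^suc≡0 k =
    solve 3 (λ m S t → con 0ℚ :* (con 0ℚ :* m) :+ con 0ℚ :* ((S :- t) :* m) := (S :- (con 1ℚ :+ t)) :* (con 0ℚ :* m)) refl m S t
  step (suc k) (inj₂ refl) rewrite 0^suc≡0 k | 1^k≡1 (suc k) =
    solve 3 (λ m S t → con 1ℚ :* (con 0ℚ :* m) :+ con 1ℚ :* ((S :- t) :* m) := ((con 1ℚ :+ S) :- (con 1ℚ :+ t)) :* (con 1ℚ :* m)) refl m S t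

evalSum : ∀ {n} → List (Monomial n) → Vec ℚ n → ℚ
evalSum [] v = 0ℚ
evalSum (b ∷ bs) v = evalMon b v + evalSum bs v

evalSum-map-∷ : ∀ {n} e (bs : List (Monomial n)) x v → evalSum (List.map (e ∷_) bs) (x ∷ v) ≡ pow x e * evalSum bs v
evalSum-map-∷ e [] x v = sym (ℚP.*-zeroʳ (pow x e))
evalSum-map-∷ e (b ∷ bs) x v =
  trans (cong (pow x e * evalMon b v +_) (evalSum-map-∷ e bs x v))
        (sym (ℚP.*-distribˡ-+ (pow x e) (evalMon b v) (evalSum bs v)))

Σ↑-evalMon : ∀ {n} (a : Monomial n) {v} → Binary v →
  Σ↑ (evalMon a) v ≡ (fromℕ n - fromℕ (support v) - fromℕ (#vars a)) * evalMon a v + evalSum (drops a) v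
Σ↑-evalMon [] [] = refl
Σ↑-evalMon {suc n} (e ∷ a) {x ∷ v} (bit ∷ bin) =
  trans (cong ((1ℚ - x) * (pow 1ℚ e * evalMon a v) +_)
              (trans (Σ-shift-*ˡ (λ x → 1ℚ - x) 1ℚ (pow x e) (evalMon a) v)
                     (cong (pow x e *_) (Σ↑-evalMon a bin))))
        (step e bit)
  where
  m = evalMon a v
  N = fromℕ n
  S = fromℕ (support v)
  t = fromℕ (#vars a)
  D = evalSum (drops a) v
  step : ∀ e {x} → Bit x → (1ℚ - x) * (pow 1ℚ e * m) + pow x e * ((N - S - t) * m + D)
         ≡ (fromℕ (suc n) - fromℕ (support (x ∷ v)) - fromℕ (#vars (e ∷ a))) * (pow x e * m)
           + evalSum (drops (e ∷ a)) (x ∷ v)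
  step zero (inj₁ refl) rewrite evalSum-map-∷ zero (drops a) 0ℚ v =
    solve 5 (λ m N S t D → (con 1ℚ :- con 0ℚ) :* (con 1ℚ :* m) :+ con 1ℚ :* ((N :- S :- t) :* m :+ D)
      := ((con 1ℚ :+ N) :- S :- t) :* (con 1ℚ :* m) :+ con 1ℚ :* D) refl m N S t D
  step zero (inj₂ refl) rewrite evalSum-map-∷ zero (drops a) 1ℚ v =
    solve 5 (λ m N S t D → (con 1ℚ :- con 1ℚ) :* (con 1ℚ :* m) :+ con 1ℚ :* ((N :- S :- t) :* m :+ D)
      := ((con 1ℚ :+ N) :- (con 1ℚ :+ S) :- t) :* (con 1ℚ :* m) :+ con 1ℚ :* D) refl m N S t D
  step (suc k) (inj₁ refl) rewrite evalSum-map-∷ (suc k) (drops a) 0ℚ v | 0^suc≡0 k | 1^k≡1 (suc k) =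
    solve 5 (λ m N S t D → (con 1ℚ :- con 0ℚ) :* (con 1ℚ :* m) :+ con 0ℚ :* ((N :- S :- t) :* m :+ D)
      := ((con 1ℚ :+ N) :- S :- (con 1ℚ :+ t)) :* (con 0ℚ :* m) :+ (con 1ℚ :* m :+ con 0ℚ :* D)) refl m N S t D
  step (suc k) (inj₂ refl) rewrite evalSum-map-∷ (suc k) (drops a) 1ℚ v | 1^k≡1 (suc k) =
    solve 5 (λ m N S t D → (con 1ℚ :- con 1ℚ) :* (con 1ℚ :* m) :+ con 1ℚ :* ((N :- S :- t) :* m :+ D)
      := ((con 1ℚ :+ N) :- (con 1ℚ :+ S) :- (con 1ℚ :+ t)) :* (con 1ℚ :* m) :+ (con 1ℚ :* m :+ con 1ℚ :* D)) refl m N S t D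

Σ↓-vanishes : ∀ {n} (g : Vec ℚ n → ℚ) {w} → Binary w →
  (∀ {v} → Binary v → suc (support v) ≡ support w → g v ≡ 0ℚ) → Σ↓ g w ≡ 0ℚ
Σ↓-vanishes g [] _ = refl
Σ↓-vanishes g {_ ∷ w} (inj₁ refl ∷ bin) g≡0 =
  trans (cong (0ℚ * g (0ℚ ∷ w) +_) (Σ↓-vanishes (λ u → g (0ℚ ∷ u)) bin (λ b eq → g≡0 (inj₁ refl ∷ b) eq)))
        (trans (ℚP.+-identityʳ (0ℚ * g (0ℚ ∷ w))) (ℚP.*-zeroˡ (g (0ℚ ∷ w))))
Σ↓-vanishes g {_ ∷ w} (inj₂ refl ∷ bin) g≡0 =
  cong₂ _+_ (cong (1ℚ *_) (g≡0 (inj₁ refl ∷ bin) refl))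
            (Σ↓-vanishes (λ u → g (1ℚ ∷ u)) bin (λ b eq → g≡0 (inj₂ refl ∷ b) (cong suc eq)))

Σ↑-vanishes : ∀ {n} (g : Vec ℚ n → ℚ) {v} → Binary v →
  (∀ {u} → Binary u → support u ≡ suc (support v) → g u ≡ 0ℚ) → Σ↑ g v ≡ 0ℚ
Σ↑-vanishes g [] _ = refl
Σ↑-vanishes g {_ ∷ v} (inj₁ refl ∷ bin) g≡0 =
  cong₂ _+_ (cong ((1ℚ - 0ℚ) *_) (g≡0 (inj₂ refl ∷ bin) refl))
            (Σ↑-vanishes (λ u → g (0ℚ ∷ u)) bin (λ b eq → g≡0 (inj₁ refl ∷ b) eq))
Σ↑-vanishes g {_ ∷ v} (inj₂ refl ∷ bin) g≡0 =
  trans (cong ((1ℚ - 1ℚ) * g (1ℚ ∷ v) +_) (Σ↑-vanishes (λ u → g (1ℚ ∷ u)) bin (λ b eq → g≡0 (inj₂ refl ∷ b) (cong suc eq))))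
        (trans (ℚP.+-identityʳ ((1ℚ - 1ℚ) * g (1ℚ ∷ v))) (ℚP.*-zeroˡ (g (1ℚ ∷ v))))

module _ {n : ℕ} where

  coeff-++ : ∀ (f g : Poly n) b → coeff (f ++ g) b ≡ coeff f b + coeff g b
  coeff-++ [] g b = sym (ℚP.+-identityˡ (coeff g b))
  coeff-++ ((c , a) ∷ f) g b with ≡-dec _≟ℕ_ a b
  ... | yes _ = trans (cong (c +_) (coeff-++ f g b)) (sym (ℚP.+-assoc c (coeff f b) (coeff g b)))
  ... | no _ = coeff-++ f g b

  eval-++ : ∀ (f g : Poly n) v → eval (f ++ g) v ≡ eval f v + eval g v
  eval-++ [] g v = sym (ℚP.+-identityˡ (eval g v))
  eval-++ ((c , a) ∷ f) g v =
    trans (cong (c * evalMon a v +_) (eval-++ f g v)) (sym (ℚP.+-assoc (c * evalMon a v) (eval f v) (eval g v)))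

  coeff-∷-≡ : ∀ c a (f : Poly n) → coeff ((c , a) ∷ f) a ≡ c + coeff f a
  coeff-∷-≡ c a f with ≡-dec _≟ℕ_ a a
  ... | yes _ = refl
  ... | no a≢a = contradiction refl a≢a

  coeff≢0⇒All : ∀ {Q : Pred (Monomial n) 0ℓ} {f : Poly n} → All (Q ∘ proj₂) f → ∀ {b} → coeff f b ≢ 0ℚ → Q b
  coeff≢0⇒All [] c≢0 = ⊥-elim (c≢0 refl)
  coeff≢0⇒All {f = (c , a) ∷ f} (qa ∷ qf) {b} c≢0 with ≡-dec _≟ℕ_ a b
  ... | yes refl = qa
  ... | no _ = coeff≢0⇒All qf c≢0

  coeff-absent : ∀ {f : Poly n} {b} → All (λ t → proj₂ t ≢ b) f → coeff f b ≡ 0ℚ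
  coeff-absent {f} {b} absent = decidable-stable (coeff f b ℚP.≟ 0ℚ) (λ c≢0 → coeff≢0⇒All absent c≢0 refl)

  restrict : {P : Pred (Monomial n) 0ℓ} → Decidable P → Poly n → Poly n
  restrict P? = filter (P? ∘ proj₂)

  module _ {P : Pred (Monomial n) 0ℓ} (P? : Decidable P) where

    coeff-restrict : ∀ f {b} → P b → coeff (restrict P? f) b ≡ coeff f b
    coeff-restrict [] pb = refl
    coeff-restrict ((c , a) ∷ f) {b} pb with P? a
    ... | yes _ with ≡-dec _≟ℕ_ a b
    ...   | yes _ = cong (c +_) (coeff-restrict f pb)
    ...   | no _ = coeff-restrict f pb
    coeff-restrict ((c , a) ∷ f) {b} pb | no ¬pa with ≡-dec _≟ℕ_ a b
    ...   | yes refl = contradiction pb ¬pa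
    ...   | no _ = coeff-restrict f pb

    coeff-restrict-∁ : ∀ f {b} → ¬ P b → coeff (restrict P? f) b ≡ 0ℚ
    coeff-restrict-∁ [] ¬pb = refl
    coeff-restrict-∁ ((c , a) ∷ f) {b} ¬pb with P? a
    ... | no _ = coeff-restrict-∁ f ¬pb
    ... | yes pa with ≡-dec _≟ℕ_ a b
    ...   | yes refl = contradiction pa ¬pb
    ...   | no _ = coeff-restrict-∁ f ¬pb

    eval-restrict : ∀ f v → eval f v ≡ eval (restrict P? f) v + eval (restrict (∁? P?) f) v
    eval-restrict [] v = refl
    eval-restrict ((c , a) ∷ f) v with P? a
    ... | yes _ = trans (cong (c * evalMon a v +_) (eval-restrict f v))
                        (sym (ℚP.+-assoc (c * evalMon a v) (eval (restrict P? f) v) (eval (restrict (∁? P?) f) v)))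
    ... | no _ = trans (cong (c * evalMon a v +_) (eval-restrict f v))
                       (solve 3 (λ x y z → x :+ (y :+ z) := y :+ (x :+ z)) refl
                              (c * evalMon a v) (eval (restrict P? f) v) (eval (restrict (∁? P?) f) v))

  eval-restrict-≡ : ∀ a (f : Poly n) v → eval (restrict (λ b → ≡-dec _≟ℕ_ b a) f) v ≡ coeff f a * evalMon a v
  eval-restrict-≡ a [] v = sym (ℚP.*-zeroˡ (evalMon a v))
  eval-restrict-≡ a ((c , b) ∷ f) v with ≡-dec _≟ℕ_ b a
  ... | yes refl = trans (cong (c * evalMon a v +_) (eval-restrict-≡ a f v))
                         (sym (ℚP.*-distribʳ-+ (evalMon a v) c (coeff f a)))
  ... | no _ = eval-restrict-≡ a f v

  eval-coeff-zero : ∀ (f : Poly n) → (∀ a → coeff f a ≡ 0ℚ) → ∀ v → eval f v ≡ 0ℚ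
  eval-coeff-zero f = byLength f (length f) ℕP.≤-refl
    where
    byLength : ∀ f k → length f ≤ k → (∀ a → coeff f a ≡ 0ℚ) → ∀ v → eval f v ≡ 0ℚ
    byLength [] _ _ _ _ = refl
    byLength f@((_ , a) ∷ _) (suc k) len≤ coeff≡0 v = begin
      eval f v                                        ≡⟨ eval-restrict (λ b → ≡-dec _≟ℕ_ b a) f v ⟩
      eval (restrict ≟a f) v + eval rest v            ≡⟨ cong₂ _+_ (eval-restrict-≡ a f v) (byLength rest k rest≤ coeff-rest≡0 v) ⟩
      coeff f a * evalMon a v + 0ℚ                     ≡⟨ cong (λ c → c * evalMon a v + 0ℚ) (coeff≡0 a) ⟩
      0ℚ * evalMon a v + 0ℚ                           ≡⟨ trans (ℚP.+-identityʳ _) (ℚP.*-zeroˡ (evalMon a v)) ⟩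
      0ℚ                                              ∎
      where
      open ≡-Reasoning
      ≟a = λ b → ≡-dec _≟ℕ_ b a
      rest = restrict (∁? ≟a) f
      rest≤ : length rest ≤ k
      rest≤ = ℕP.<⇒≤pred (ℕP.<-≤-trans (filter-notAll (∁? ≟a ∘ proj₂) f (here (λ a≢a → a≢a refl))) len≤)
      coeff-rest≡0 : ∀ b → coeff rest b ≡ 0ℚ
      coeff-rest≡0 b with ≡-dec _≟ℕ_ b a
      ... | yes b≡a = coeff-restrict-∁ (∁? ≟a) f (λ b≢a → b≢a b≡a)
      ... | no b≢a = trans (coeff-restrict (∁? ≟a) f b≢a) (coeff≡0 b)

module _ {n : ℕ} where

  Σ↓-poly : ℕ → Poly n → Poly n
  Σ↓-poly k [] = []
  Σ↓-poly k ((c , a) ∷ f) = (c * (fromℕ k - fromℕ (#vars a)) , a) ∷ Σ↓-poly k f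

  coeff-Σ↓-poly : ∀ k (f : Poly n) b → coeff (Σ↓-poly k f) b ≡ coeff f b * (fromℕ k - fromℕ (#vars b))
  coeff-Σ↓-poly k [] b = sym (ℚP.*-zeroˡ (fromℕ k - fromℕ (#vars b)))
  coeff-Σ↓-poly k ((c , a) ∷ f) b with ≡-dec _≟ℕ_ a b
  ... | yes refl = trans (cong (c * (fromℕ k - fromℕ (#vars a)) +_) (coeff-Σ↓-poly k f b))
                         (sym (ℚP.*-distribʳ-+ (fromℕ k - fromℕ (#vars a)) c (coeff f b)))
  ... | no _ = coeff-Σ↓-poly k f b

  eval-Σ↓-poly : ∀ (f : Poly n) {w} → Binary w → eval (Σ↓-poly (support w) f) w ≡ Σ↓ (eval f) w
  eval-Σ↓-poly [] {w} _ = sym (Σ-shift-zero (λ x → x) 0ℚ w)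
  eval-Σ↓-poly ((c , a) ∷ f) {w} bin = begin
    c * (fromℕ k - fromℕ (#vars a)) * evalMon a w + eval (Σ↓-poly k f) w
      ≡⟨ cong₂ _+_ (ℚP.*-assoc c _ (evalMon a w)) (eval-Σ↓-poly f bin) ⟩
    c * ((fromℕ k - fromℕ (#vars a)) * evalMon a w) + Σ↓ (eval f) w
      ≡⟨ cong (λ x → c * x + Σ↓ (eval f) w) (Σ↓-evalMon a bin) ⟨
    c * Σ↓ (evalMon a) w + Σ↓ (eval f) w
      ≡⟨ cong (_+ Σ↓ (eval f) w) (Σ-shift-*ˡ (λ x → x) 0ℚ c (evalMon a) w) ⟨
    Σ↓ (λ u → c * evalMon a u) w + Σ↓ (eval f) w
      ≡⟨ Σ-shift-+ (λ x → x) 0ℚ (λ u → c * evalMon a u) (eval f) w ⟨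
    Σ↓ (eval ((c , a) ∷ f)) w ∎
    where
    open ≡-Reasoning
    k = support w

  -- the scalar by which Σ↑ acts on x^a, up to lower terms, at level k
  μ : ℕ → Monomial n → ℚ
  μ k a = fromℕ n - fromℕ k - fromℕ (#vars a)

  Σ↑-term : ℕ → ℚ × Monomial n → Poly n
  Σ↑-term k (c , a) = (c * μ k a , a) ∷ List.map (c ,_) (drops a)

  Σ↑-poly : ℕ → Poly n → Poly n
  Σ↑-poly k = concatMap (Σ↑-term k)

  eval-map-, : ∀ c (bs : List (Monomial n)) v → eval (List.map (c ,_) bs) v ≡ c * evalSum bs v
  eval-map-, c [] v = sym (ℚP.*-zeroʳ c)
  eval-map-, c (b ∷ bs) v =
    trans (cong (c * evalMon b v +_) (eval-map-, c bs v)) (sym (ℚP.*-distribˡ-+ c (evalMon b v) (evalSum bs v)))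

  eval-Σ↑-poly : ∀ (f : Poly n) {v} → Binary v → eval (Σ↑-poly (support v) f) v ≡ Σ↑ (eval f) v
  eval-Σ↑-poly [] {v} _ = sym (Σ-shift-zero (λ x → 1ℚ - x) 1ℚ v)
  eval-Σ↑-poly ((c , a) ∷ f) {v} bin = begin
    eval (Σ↑-term k (c , a) ++ Σ↑-poly k f) v
      ≡⟨ eval-++ (Σ↑-term k (c , a)) (Σ↑-poly k f) v ⟩
    c * μ k a * evalMon a v + eval (List.map (c ,_) (drops a)) v + eval (Σ↑-poly k f) v
      ≡⟨ cong₂ _+_ (cong (c * μ k a * evalMon a v +_) (eval-map-, c (drops a) v)) (eval-Σ↑-poly f bin) ⟩
    c * μ k a * evalMon a v + c * evalSum (drops a) v + Σ↑ (eval f) v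
      ≡⟨ cong (_+ Σ↑ (eval f) v) (solve 4 (λ c m e s → c :* m :* e :+ c :* s := c :* (m :* e :+ s)) refl
                                          c (μ k a) (evalMon a v) (evalSum (drops a) v)) ⟩
    c * (μ k a * evalMon a v + evalSum (drops a) v) + Σ↑ (eval f) v
      ≡⟨ cong (λ x → c * x + Σ↑ (eval f) v) (Σ↑-evalMon a bin) ⟨
    c * Σ↑ (evalMon a) v + Σ↑ (eval f) v
      ≡⟨ cong (_+ Σ↑ (eval f) v) (Σ-shift-*ˡ _ _ c (evalMon a) v) ⟨
    Σ↑ (λ u → c * evalMon a u) v + Σ↑ (eval f) v
      ≡⟨ Σ-shift-+ _ _ (λ u → c * evalMon a u) (eval f) v ⟨
    Σ↑ (eval ((c , a) ∷ f)) v ∎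
    where
    open ≡-Reasoning
    k = support v

  Σ↓-poly-∈I : ∀ {k} (f : Poly n) → InIdeal (𝒱 n k) f → InIdeal (𝒱 n (suc k)) (Σ↓-poly (suc k) f)
  Σ↓-poly-∈I f f∈I w w∈𝒱@(_ , level) =
    subst (λ j → eval (Σ↓-poly j f) w ≡ 0ℚ) level
      (trans (eval-Σ↓-poly f bin)
             (Σ↓-vanishes (eval f) bin (λ b eq → f∈I _ (binary⇒𝒱 b (ℕP.suc-injective (trans eq level))))))
    where bin = 𝒱⇒binary w∈𝒱

  Σ↑-poly-∈I : ∀ {k} (f : Poly n) → InIdeal (𝒱 n (suc k)) f → InIdeal (𝒱 n k) (Σ↑-poly k f)
  Σ↑-poly-∈I f f∈I v v∈𝒱@(_ , level) =
    subst (λ j → eval (Σ↑-poly j f) v ≡ 0ℚ) level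
      (trans (eval-Σ↑-poly f bin)
             (Σ↑-vanishes (eval f) bin (λ b eq → f∈I _ (binary⇒𝒱 b (trans eq (cong suc level))))))
    where bin = 𝒱⇒binary v∈𝒱

  μ≢0 : ∀ {k} a → #vars a ℕ.+ k < n → μ k a ≢ 0ℚ
  μ≢0 {k} a bound =
    subst (λ x → x - fromℕ (#vars a) ≢ 0ℚ) (sym (fromℕ-∸ (ℕP.m+n≤o⇒n≤o (suc (#vars a)) bound)))
          (fromℕ-∸≢0 (ℕP.m+n≤o⇒m≤o∸n (suc (#vars a)) bound))

-- Leading monomials

module MonomialOrderProperties {n : ℕ} (O : MonomialOrder n) where
  open MonomialOrder O
  open IsStrictTotalOrder isStrictTotalOrder using (compare; _<?_) renaming (trans to ≺-trans; irrefl to ≺-irrefl)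

  _≼_ : Monomial n → Monomial n → Set
  a ≼ b = a ≡ b ⊎ a ≺ b

  ≺-≼-trans : ∀ {a b c} → a ≺ b → b ≼ c → a ≺ c
  ≺-≼-trans a≺b (inj₁ refl) = a≺b
  ≺-≼-trans a≺b (inj₂ b≺c) = ≺-trans a≺b b≺c

  ⊁⇒≼ : ∀ {a b} → ¬ b ≺ a → a ≼ b
  ⊁⇒≼ {a} {b} b⊀a with compare a b
  ... | tri< a≺b _ _ = inj₂ a≺b
  ... | tri≈ _ a≡b _ = inj₁ a≡b
  ... | tri> _ _ b≺a = contradiction b≺a b⊀a

  -- c ≺ one would give the infinite descending chain x ≻ c·x ≻ c·c·x ≻ ⋯
  one≺ : ∀ {c} → c ≢ one → one ≺ c
  one≺ {c} c≢1 with compare one c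
  ... | tri< 1≺c _ _ = 1≺c
  ... | tri≈ _ 1≡c _ = contradiction (sym 1≡c) c≢1
  ... | tri> _ _ c≺1 = ⊥-elim (noDescent (wellFounded one))
    where
    noDescent : ∀ {x} → Acc _≺_ x → ⊥
    noDescent {x} (acc rs) = noDescent (rs (subst ((c · x) ≺_) (·-identityˡ x) (multiplicative c one x c≺1)))

  properlyDivides⇒≺ : ∀ {b a} → ProperlyDivides b a → b ≺ a
  properlyDivides⇒≺ {b} (c , c≢1 , refl) =
    subst (_≺ (c · b)) (·-identityˡ b) (multiplicative one c b (one≺ c≢1))

  drops-≺ : ∀ a → All (_≺ a) (drops a)
  drops-≺ a = All.map properlyDivides⇒≺ (drops-properlyDivide a)

  coeff-above-leading : ∀ f {m b} → IsLeadingMonomial O f m → m ≺ b → coeff f b ≡ 0ℚ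
  coeff-above-leading f {m} {b} (_ , lead) m≺b =
    decidable-stable (coeff f b ℚP.≟ 0ℚ) (λ c≢0 → ≺-irrefl refl (≺-≼-trans m≺b (lead b c≢0)))

  -- A monomial may recur in a polynomial, so terms above its leading monomial can
  -- still be present, with cancelling coefficients; trimAbove discards them.
  trimAbove : Monomial n → Poly n → Poly n
  trimAbove m = restrict (∁? (m <?_))

  eval-trimAbove : ∀ f {m} → IsLeadingMonomial O f m → ∀ v → eval (trimAbove m f) v ≡ eval f v
  eval-trimAbove f {m} lead v = begin
    eval (trimAbove m f) v                                   ≡⟨ ℚP.+-identityˡ _ ⟨
    0ℚ + eval (trimAbove m f) v                              ≡⟨ cong (_+ eval (trimAbove m f) v) above≡0 ⟨
    eval (restrict (m <?_) f) v + eval (trimAbove m f) v      ≡⟨ eval-restrict (m <?_) f v ⟨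
    eval f v                                                 ∎
    where
    open ≡-Reasoning
    above≡0 : eval (restrict (m <?_) f) v ≡ 0ℚ
    above≡0 = eval-coeff-zero (restrict (m <?_) f) coeff≡0 v
      where
      coeff≡0 : ∀ b → coeff (restrict (m <?_) f) b ≡ 0ℚ
      coeff≡0 b with m <? b
      ... | yes m≺b = trans (coeff-restrict (m <?_) f m≺b) (coeff-above-leading f lead m≺b)
      ... | no m⊀b = coeff-restrict-∁ (m <?_) f m⊀b

  trimAbove-leading : ∀ f {m} → IsLeadingMonomial O f m → IsLeadingMonomial O (trimAbove m f) m
  trimAbove-leading f {m} (c≢0 , lead) =
    subst (_≢ 0ℚ) (sym (coeff-restrict (∁? (m <?_)) f (λ m≺m → ≺-irrefl refl m≺m))) c≢0 ,
    λ b c≢0 → ⊁⇒≼ (coeff≢0⇒All {f = trimAbove m f} (all-filter (∁? (m <?_) ∘ proj₂) f) c≢0)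

  module _ {m : Monomial n} where

    drops-absent : ∀ {a} (c : ℚ) → ¬ m ≺ a → All (λ t → proj₂ t ≢ m) (List.map (c ,_) (drops a))
    drops-absent c m⊀a = map⁺ (All.map (λ { b≺a refl → ≺-irrefl refl (≺-≼-trans b≺a (⊁⇒≼ m⊀a)) }) (drops-≺ _))

    coeff-Σ↑-term : ∀ k c a → ¬ m ≺ a → coeff (Σ↑-term k (c , a)) m ≡ coeff [ c , a ] m * μ k m
    coeff-Σ↑-term k c a m⊀a with ≡-dec _≟ℕ_ a m
    ... | yes refl = begin
      c * μ k a + coeff (List.map (c ,_) (drops a)) a  ≡⟨ cong (c * μ k a +_) (coeff-absent (drops-absent c m⊀a)) ⟩
      c * μ k a + 0ℚ                                      ≡⟨ ℚP.+-identityʳ _ ⟩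
      c * μ k a                                           ≡⟨ cong (_* μ k a) (ℚP.+-identityʳ c) ⟨
      (c + 0ℚ) * μ k a                                    ∎
      where open ≡-Reasoning
    ... | no _ = trans (coeff-absent (drops-absent c m⊀a)) (sym (ℚP.*-zeroˡ (μ k m)))

    coeff-Σ↑-poly : ∀ k (f : Poly n) → All (λ t → ¬ m ≺ proj₂ t) f → coeff (Σ↑-poly k f) m ≡ coeff f m * μ k m
    coeff-Σ↑-poly k [] [] = sym (ℚP.*-zeroˡ (μ k m))
    coeff-Σ↑-poly k ((c , a) ∷ f) (m⊀a ∷ m⊀f) = begin
      coeff (Σ↑-term k (c , a) ++ Σ↑-poly k f) m            ≡⟨ coeff-++ (Σ↑-term k (c , a)) (Σ↑-poly k f) m ⟩
      coeff (Σ↑-term k (c , a)) m + coeff (Σ↑-poly k f) m  ≡⟨ cong₂ _+_ (coeff-Σ↑-term k c a m⊀a) (coeff-Σ↑-poly k f m⊀f) ⟩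
      coeff [ c , a ] m * μ k m + coeff f m * μ k m         ≡⟨ ℚP.*-distribʳ-+ (μ k m) (coeff [ c , a ] m) (coeff f m) ⟨
      (coeff [ c , a ] m + coeff f m) * μ k m               ≡⟨ cong (_* μ k m) (coeff-++ [ c , a ] f m) ⟨
      coeff ((c , a) ∷ f) m * μ k m                         ∎
      where open ≡-Reasoning

    Σ↑-poly-≼ : ∀ k (f : Poly n) → All (λ t → ¬ m ≺ proj₂ t) f → All ((_≼ m) ∘ proj₂) (Σ↑-poly k f)
    Σ↑-poly-≼ k [] [] = []
    Σ↑-poly-≼ k ((c , a) ∷ f) (m⊀a ∷ m⊀f) =
      ++⁺ (⊁⇒≼ m⊀a ∷ map⁺ (All.map (λ b≺a → inj₂ (≺-≼-trans b≺a (⊁⇒≼ m⊀a))) (drops-≺ a)))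
          (Σ↑-poly-≼ k f m⊀f)

  leading-Σ↓-poly : ∀ {k} f {m} → #vars m ≤ k → IsLeadingMonomial O f m → IsLeadingMonomial O (Σ↓-poly (suc k) f) m
  leading-Σ↓-poly {k} f {m} t≤k (c≢0 , lead) =
    (λ c′≡0 → *-≢0 c≢0 (fromℕ-∸≢0 (ℕ.s≤s t≤k)) (trans (sym (coeff-Σ↓-poly (suc k) f m)) c′≡0)) ,
    (λ b c′≢0 → lead b (p*q≢0⇒p≢0 (λ eq → c′≢0 (trans (coeff-Σ↓-poly (suc k) f b) eq))))

  leading-Σ↑-poly : ∀ {k} f {m} → #vars m ℕ.+ k < n → IsLeadingMonomial O f m →
    IsLeadingMonomial O (Σ↑-poly k (trimAbove m f)) m
  leading-Σ↑-poly {k} f {m} bound lead with trimAbove-leading f lead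
  ... | c≢0 , _ =
    (λ c′≡0 → *-≢0 c≢0 (μ≢0 m bound) (trans (sym (coeff-Σ↑-poly k (trimAbove m f) m⊀f)) c′≡0)) ,
    (λ b → coeff≢0⇒All (Σ↑-poly-≼ k (trimAbove m f) m⊀f))
    where
    m⊀f : All (λ t → ¬ m ≺ proj₂ t) (trimAbove m f)
    m⊀f = all-filter (∁? (m <?_) ∘ proj₂) f

  -- Standard monomials

  Standard : ℕ → Monomial n → Set
  Standard k = IsStandard O (𝒱 n k)

  leading-∷ : ∀ {c m} {f : Poly n} → c ≢ 0ℚ → All ((_≺ m) ∘ proj₂) f → IsLeadingMonomial O ((c , m) ∷ f) m
  leading-∷ {c} {m} {f} c≢0 f≺m =
    subst (_≢ 0ℚ) (sym coeff≡c) c≢0 ,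
    (λ b → coeff≢0⇒All {Q = _≼ m} {f = (c , m) ∷ f} (inj₁ refl ∷ All.map inj₂ f≺m))
    where
    coeff≡c : coeff ((c , m) ∷ f) m ≡ c
    coeff≡c = begin
      coeff ((c , m) ∷ f) m  ≡⟨ coeff-∷-≡ c m f ⟩
      c + coeff f m          ≡⟨ cong (c +_) (coeff-absent (All.map (λ { b≺m refl → ≺-irrefl refl b≺m }) f≺m)) ⟩
      c + 0ℚ                 ≡⟨ ℚP.+-identityʳ c ⟩
      c                      ∎
      where open ≡-Reasoning

  ¬standard-above-level : ∀ {k m} → k < #vars m → ¬ Standard k m
  ¬standard-above-level {k} {m} k<t std = std ([ 1ℚ , m ] , m∈I , leading-∷ (λ ()) [])
    where
    m∈I : InIdeal (𝒱 n k) [ 1ℚ , m ]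
    m∈I v v∈𝒱@(_ , level) =
      cong (λ x → 1ℚ * x + 0ℚ) (evalMon-vanishes m (𝒱⇒binary v∈𝒱) (subst (_< #vars m) (sym level) k<t))

  ¬standard-repeated-variable : ∀ {k m} → #vars m < deg m → ¬ Standard k m
  ¬standard-repeated-variable {k} {m} t<deg std with lowerExponent m t<deg
  ... | b , b∣m , same = std (f , f∈I , leading-∷ (λ ()) (properlyDivides⇒≺ b∣m ∷ []))
    where
    f : Poly n
    f = (1ℚ , m) ∷ (- 1ℚ , b) ∷ []
    f∈I : InIdeal (𝒱 n k) f
    f∈I v v∈𝒱 =
      trans (cong (λ x → 1ℚ * x + (- 1ℚ * evalMon b v + 0ℚ)) (same (𝒱⇒binary v∈𝒱)))
            (solve 1 (λ x → con 1ℚ :* x :+ ((:- con 1ℚ) :* x :+ con 0ℚ) := con 0ℚ) refl (evalMon b v))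

  standard⇒deg≤ : ∀ {k m} → Standard k m → deg m ≤ k
  standard⇒deg≤ {k} {m} std = ℕP.≤-trans deg≤t t≤k
    where
    deg≤t : deg m ≤ #vars m
    deg≤t = ℕP.≮⇒≥ (λ t<deg → ¬standard-repeated-variable t<deg std)
    t≤k : #vars m ≤ k
    t≤k = ℕP.≮⇒≥ (λ k<t → ¬standard-above-level k<t std)

  standard-suc⇒standard : ∀ {k m} → #vars m ≤ k → Standard (suc k) m → Standard k m
  standard-suc⇒standard {k} t≤k std (f , f∈I , lead) =
    std (Σ↓-poly (suc k) f , Σ↓-poly-∈I f f∈I , leading-Σ↓-poly f t≤k lead)

  standard⇒standard-suc : ∀ {k m} → #vars m ℕ.+ k < n → Standard k m → Standard (suc k) m
  standard⇒standard-suc {k} {m} bound std (f , f∈I , lead) =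
    std (Σ↑-poly k (trimAbove m f) , Σ↑-poly-∈I (trimAbove m f) trim∈I , leading-Σ↑-poly f bound lead)
    where
    trim∈I : InIdeal (𝒱 n (suc k)) (trimAbove m f)
    trim∈I v v∈𝒱 = trans (eval-trimAbove f lead v) (f∈I v v∈𝒱)

  standard⇔standard-+ : ∀ e {k m} → #vars m ≤ k → #vars m ℕ.+ (e ℕ.+ k) ≤ n → Standard k m ⇔ Standard (e ℕ.+ k) m
  standard⇔standard-+ zero _ _ = ⇔.refl
  standard⇔standard-+ (suc e) {k} {m} t≤k bound =
    ⇔.trans (standard⇔standard-+ e t≤k (ℕP.<⇒≤ bound′))
            (mk⇔ (standard⇒standard-suc bound′)
                 (standard-suc⇒standard (ℕP.≤-trans t≤k (ℕP.m≤n+m k e))))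
    where
    bound′ : #vars m ℕ.+ (e ℕ.+ k) < n
    bound′ = subst (_≤ n) (ℕP.+-suc (#vars m) (e ℕ.+ k)) bound

corollary13 : (n d s : ℕ) → d ≤ n → s ≤ d → s ≤ n ∸ d →
    (O : MonomialOrder n) → (m : Monomial n) →
    (IsStandard O (𝒱 n d) m × deg m ≤ s) ⇔ IsStandard O (𝒱 n s) m
corollary13 n d s d≤n s≤d s≤n∸d O m = mk⇔
  (λ (std , deg≤s) → Equivalence.from (standard-s⇔standard-d (ℕP.≤-trans (#vars≤deg m) deg≤s)) std)
  (λ std → let deg≤s = standard⇒deg≤ std in
           Equivalence.to (standard-s⇔standard-d (ℕP.≤-trans (#vars≤deg m) deg≤s)) std , deg≤s)
  where
  open MonomialOrderProperties O
  d∸s+s≡d : d ∸ s ℕ.+ s ≡ d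
  d∸s+s≡d = ℕP.m∸n+n≡m s≤d

  standard-s⇔standard-d : #vars m ≤ s → Standard s m ⇔ Standard d m
  standard-s⇔standard-d t≤s = subst (λ k → Standard s m ⇔ Standard k m) d∸s+s≡d (standard⇔standard-+ (d ∸ s) t≤s bound)
    where
    open ℕP.≤-Reasoning
    bound : #vars m ℕ.+ (d ∸ s ℕ.+ s) ≤ n
    bound = begin
      #vars m ℕ.+ (d ∸ s ℕ.+ s)  ≡⟨ cong (#vars m ℕ.+_) d∸s+s≡d ⟩
      #vars m ℕ.+ d              ≤⟨ ℕP.+-monoˡ-≤ d (ℕP.≤-trans t≤s s≤n∸d) ⟩
      n ∸ d ℕ.+ d                ≡⟨ ℕP.m∸n+n≡m d≤n ⟩
      n                          ∎
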